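{- SESs are strictly less expressive than RCESs: for every SES $\sigma$ there is an RCES that is transition equivalent to $\sigma$, and there is an RCES that is not transition equivalent to any SES.
   Context: An SES is a tuple $\sigma=(E,\#,\to,\mathrm{Drop})$: $E$ a set of events, $\#\subseteq E^2$ irreflexive and symmetric, $\to\subseteq E^2$, $\mathrm{Drop}\subseteq E^3$ with $(d,c,t)\in\mathrm{Drop}$ implying $c\to t$ and $d\notin\{c,t\}$. Let $\mathrm{ic}(e)=\{e'\mid e'\to e\}$, $\mathrm{dc}(H,e)=\{e'\mid\exists d\in H.(d,e',e)\in\mathrm{Drop}\}$. $X\mapsto_\sigma Y$ iff $X\subsetneq Y$, no two events of $Y$ are in conflict, and $\mathrm{ic}(e)\setminus\mathrm{dc}(X,e)\subseteq X$ for all $e\in Y\setminus X$; $\mathcal C(\sigma)$ is the set of finite $X\subseteq E$ with $\emptyset\mapsto_\sigma^* X$. An Event Structure for Resolvable Conflicts (RCES) is $\rho=(E,\vdash)$ with $E$ a set of events and $\vdash\subseteq\mathcal P(E)^2$. For $X,Y\subseteq E$: $X\mapsto_\rho Y$ iff $X\subsetneq Y$ and for every $Z\subseteq Y$ there is $W\subseteq X$ with $W\vdash Z$. $\mathcal C(\rho)$ is the set of finite $X$ with $\emptyset\mapsto_\rho^*X$. Two structures $\mu_1,\mu_2$ of these kinds are transition equivalent if they have the same reachable transition graph: $\mathcal C(\mu_1)=\mathcal C(\mu_2)$ and $\mapsto_{\mu_1}\cap\,\mathcal C(\mu_1)^2=\mapsto_{\mu_2}\cap\,\mathcal C(\mu_2)^2$.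 -}

module Defs where

open import Level using (0ℓ)
open import Data.Product using (Σ; ∃; _×_; _,_)
open import Data.List using (List)
open import Relation.Nullary using (¬_)
open import Relation.Unary using (Pred; _∈_; _∉_; _⊆_; _⊂_; ∅)
open import Relation.Binary.Construct.Closure.ReflexiveTransitive using (Star)
open import Function.Bundles using (_⇔_)
open import Relation.Binary.PropositionalEquality using (_≡_)
import Data.List.Membership.Propositional as LMem

Subset : Set → Set₁
Subset E = Pred E 0ℓ

Finite : {E : Set} → Subset E → Set
Finite {E} X = Σ (List E) λ xs → ∀ e → e ∈ X → LMem._∈_ e xs

record SES (E : Set) : Set₁ where
  field
    _#_   : E → E → Set
    _⟶_   : E → E → Set
    Drop  : E → E → E → Set
    #-irrefl : ∀ e → ¬ (e # e)
    #-sym    : ∀ e e' → e # e' → e' # e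
    Drop-en  : ∀ d c t → Drop d c t → c ⟶ t
    Drop-d≢c : ∀ d c t → Drop d c t → ¬ (d ≡ c)
    Drop-d≢t : ∀ d c t → Drop d c t → ¬ (d ≡ t)
  ic : E → Subset E
  ic e e' = e' ⟶ e
  dc : Subset E → E → Subset E
  dc H e e' = ∃ λ d → d ∈ H × Drop d e' e

module _ {E : Set} (σ : SES E) where
  open SES σ

  ConflictFree : Subset E → Set
  ConflictFree Y = ∀ e e' → e ∈ Y → e' ∈ Y → ¬ (e # e')

  SES-step : Subset E → Subset E → Set
  SES-step X Y =
    X ⊂ Y × ConflictFree Y ×
    (∀ e → e ∈ Y → e ∉ X → ∀ e' → e' ∈ ic e → e' ∉ dc X e → e' ∈ X)

  SES-conf : Subset E → Set₁
  SES-conf X = Finite X × Star SES-step ∅ X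

record RCES (E : Set) : Set₁ where
  field
    _⊢_ : Subset E → Subset E → Set

module _ {E : Set} (ρ : RCES E) where
  open RCES ρ

  RCES-step : Subset E → Subset E → Set₁
  RCES-step X Y = X ⊂ Y × (∀ (Z : Subset E) → Z ⊆ Y → ∃ λ (W : Subset E) → W ⊆ X × W ⊢ Z)

  RCES-conf : Subset E → Set₁
  RCES-conf X = Finite X × Star RCES-step ∅ X

TransEquiv : {E : Set} → SES E → RCES E → Set₁
TransEquiv {E} σ ρ =
  (∀ (X : Subset E) → SES-conf σ X ⇔ RCES-conf ρ X) ×
  (∀ (X Y : Subset E) →
     (SES-conf σ X × SES-conf σ Y × SES-step σ X Y)
       ⇔ (RCES-conf ρ X × RCES-conf ρ Y × RCES-step ρ X Y))

-- An SES transition X ↦ Y is a local condition on the pair (X, Y): Y is conflict free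
-- and each new event is enabled by X. Taking W ⊢ Z to be exactly that condition for
-- (W, Z) yields an RCES with the same transitions. Conversely, SES transitions are
-- pairwise determined: conflicts are binary and enabling concerns single events, so
-- whenever ∅ ↦ {x, y} for all x, y ∈ {a, b, c}, also ∅ ↦ {a, b, c}. The RCES whose
-- only forbidden set is {a, b, c} allows the former but never reaches the latter.
module Submission where

open import Defs
open import Data.Product using (Σ; ∃; _×_; _,_; proj₂)
open import Data.Sum using (_⊎_; inj₁; inj₂)
open import Data.Unit using (tt)
open import Data.List using ([]; _∷_)
open import Data.List.Relation.Unary.Any using (here; there)
open import Relation.Nullary using (¬_)
open import Relation.Unary using (_∈_; _∉_; _⊆_; _⊂_; ∅; U)
open import Relation.Binary.Construct.Closure.ReflexiveTransitive using (Star; ε; _◅_; map)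
open import Relation.Binary.PropositionalEquality using (_≡_; _≢_; refl)
open import Function.Bundles using (_⇔_; mk⇔; Equivalence)

module _ {E : Set} (σ : SES E) where
  open SES σ

  Enables : Subset E → Subset E → Set
  Enables X Y = ∀ e → e ∈ Y → e ∉ X → ∀ e' → e' ∈ ic e → e' ∉ dc X e → e' ∈ X

  SES⇒RCES : RCES E
  SES⇒RCES = record { _⊢_ = λ W Z → ConflictFree σ Z × Enables W Z }

  Enables-mono : ∀ {W X Y} → W ⊆ X → Enables W Y → Enables X Y
  Enables-mono W⊆X en e e∈Y e∉X e' e'↦e e'∉dc =
    W⊆X (en e e∈Y (λ e∈W → e∉X (W⊆X e∈W)) e'
           e'↦e (λ { (d , d∈W , drop) → e'∉dc (d , W⊆X d∈W , drop) }))

  SES-step⇔RCES-step : ∀ X Y → SES-step σ X Y ⇔ RCES-step SES⇒RCES X Y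
  SES-step⇔RCES-step X Y = mk⇔ to from
    where
    to : SES-step σ X Y → RCES-step SES⇒RCES X Y
    to (X⊂Y , cf , en) = X⊂Y , λ Z Z⊆Y → X , (λ x → x) ,
      (λ e e' e∈Z e'∈Z → cf e e' (Z⊆Y e∈Z) (Z⊆Y e'∈Z)) ,
      (λ e e∈Z → en e (Z⊆Y e∈Z))

    from : RCES-step SES⇒RCES X Y → SES-step σ X Y
    from (X⊂Y , ⊢) with ⊢ Y (λ y → y)
    ... | W , W⊆X , cf , en = X⊂Y , cf , Enables-mono W⊆X en

  SES-step-pairwise : ∀ {X Y} → X ⊂ Y →
    (∀ {e e'} → e ∈ Y → e' ∈ Y → ∃ λ Y' → SES-step σ X Y' × e ∈ Y' × e' ∈ Y') →
    SES-step σ X Y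
  SES-step-pairwise X⊂Y pair = X⊂Y , conflictFree , enables
    where
    conflictFree : ConflictFree σ _
    conflictFree e e' e∈Y e'∈Y with pair e∈Y e'∈Y
    ... | Y' , (_ , cf , _) , e∈Y' , e'∈Y' = cf e e' e∈Y' e'∈Y'

    enables : Enables _ _
    enables e e∈Y with pair e∈Y e∈Y
    ... | Y' , (_ , _ , en) , e∈Y' , _ = en e e∈Y'

TransEquiv-from-step⇔ : ∀ {E} (σ : SES E) (ρ : RCES E) →
  (∀ X Y → SES-step σ X Y ⇔ RCES-step ρ X Y) → TransEquiv σ ρ
TransEquiv-from-step⇔ σ ρ step⇔ = conf⇔ , λ X Y →
  mk⇔ (λ { (cX , cY , s) → to (conf⇔ X) cX , to (conf⇔ Y) cY , to (step⇔ X Y) s })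
      (λ { (cX , cY , s) → from (conf⇔ X) cX , from (conf⇔ Y) cY , from (step⇔ X Y) s })
  where
  open Equivalence
  conf⇔ : ∀ X → SES-conf σ X ⇔ RCES-conf ρ X
  conf⇔ X = mk⇔ (λ { (fin , run) → fin , map (to (step⇔ _ _)) run })
                (λ { (fin , run) → fin , map (from (step⇔ _ _)) run })

data E3 : Set where
  a b c : E3

Pair : E3 → E3 → Subset E3
Pair x y e = e ≡ x ⊎ e ≡ y

Pair-finite : ∀ x y → Finite (Pair x y)
Pair-finite x y = x ∷ y ∷ [] , λ { _ (inj₁ refl) → here refl ; _ (inj₂ refl) → there (here refl) }

U-finite : Finite {E3} U
U-finite = a ∷ b ∷ c ∷ [] , λ { a _ → here refl ; b _ → there (here refl) ; c _ → there (there (here refl)) }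

Full : Subset E3 → Set
Full Z = ∀ e → e ∈ Z

third : (x y : E3) → ∃ λ z → z ≢ x × z ≢ y
third a a = b , (λ ()) , (λ ())
third a b = c , (λ ()) , (λ ())
third a c = b , (λ ()) , (λ ())
third b a = c , (λ ()) , (λ ())
third b b = a , (λ ()) , (λ ())
third b c = a , (λ ()) , (λ ())
third c a = b , (λ ()) , (λ ())
third c b = a , (λ ()) , (λ ())
third c c = a , (λ ()) , (λ ())

Pair-not-full : ∀ x y → ¬ Full (Pair x y)
Pair-not-full x y full with third x y
... | z , z≢x , z≢y with full z
...   | inj₁ z≡x = z≢x z≡x
...   | inj₂ z≡y = z≢y z≡y

ρ-no-triple : RCES E3
ρ-no-triple = record { _⊢_ = λ _ Z → ¬ Full Z }

∅⊂Pair : ∀ x y → ∅ ⊂ Pair x y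
∅⊂Pair x y = (λ ()) , λ Pair⊆∅ → Pair⊆∅ (inj₁ refl)

∅-conf : RCES-conf ρ-no-triple ∅
∅-conf = ([] , λ _ ()) , ε

∅↦Pair : ∀ x y → RCES-step ρ-no-triple ∅ (Pair x y)
∅↦Pair x y = ∅⊂Pair x y , λ Z Z⊆Pair → ∅ , (λ ()) ,
  λ full → Pair-not-full x y (λ e → Z⊆Pair (full e))

reachable-not-full : ∀ {X Y} → Star (RCES-step ρ-no-triple) X Y → ¬ Full X → ¬ Full Y
reachable-not-full ε ¬full = ¬full
reachable-not-full ((_ , ⊢) ◅ run) _ = reachable-not-full run (proj₂ (proj₂ (⊢ _ (λ y → y))))

no-SES-for-ρ-no-triple : (σ : SES E3) → ¬ TransEquiv σ ρ-no-triple
no-SES-for-ρ-no-triple σ (conf⇔ , step⇔) =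
  reachable-not-full (proj₂ U-conf) (λ full → full a) (λ _ → tt)
  where
  open Equivalence
  ∅↦Pair-SES : ∀ x y → SES-step σ ∅ (Pair x y)
  ∅↦Pair-SES x y = proj₂ (proj₂ (from (step⇔ ∅ (Pair x y))
    (∅-conf , (Pair-finite x y , ∅↦Pair x y ◅ ε) , ∅↦Pair x y)))

  ∅↦U : SES-step σ ∅ U
  ∅↦U = SES-step-pairwise σ ((λ ()) , λ U⊆∅ → U⊆∅ {a} tt)
    λ {e} {e'} _ _ → Pair e e' , ∅↦Pair-SES e e' , inj₁ refl , inj₂ refl

  U-conf : RCES-conf ρ-no-triple U
  U-conf = to (conf⇔ U) (U-finite , ∅↦U ◅ ε)

theorem4p20 :
  ((E : Set) → (σ : SES E) → Σ (RCES E) λ ρ → TransEquiv σ ρ) ×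
  Σ Set (λ E → Σ (RCES E) λ ρ → (σ : SES E) → ¬ TransEquiv σ ρ)
theorem4p20 =
  (λ E σ → SES⇒RCES σ , TransEquiv-from-step⇔ σ (SES⇒RCES σ) (SES-step⇔RCES-step σ)) ,
  (E3 , ρ-no-triple , no-SES-for-ρ-no-triple)
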